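{- Let $k$ be a natural number and $\circ \in \{\land, \lor\}$. Then: (A) If $\varphi \in \Sigma_{k+1}^+$, $\psi \in \Sigma_{k+1}^+$ and $k+1 = \max\{\deg(\varphi), \deg(\psi)\}$, then there is $\sigma \in \Sigma_{k+1}$ with $\varphi \circ \psi \rhd^* \sigma$. (B) If $\varphi \in \Pi_{k+1}^+$, $\psi \in \Pi_{k+1}^+$ and $k+1 = \max\{\deg(\varphi), \deg(\psi)\}$, then there is $\pi \in \Pi_{k+1}$ with $\varphi \circ \psi \rhd^* \pi$. (C) If $\varphi \in \Sigma_{k+1}$ and $\psi \in \Pi_{k+1}$, then there are $\sigma \in \Sigma_{k+2}$ and $\pi \in \Pi_{k+2}$ with $\varphi \circ \psi \rhd^* \sigma$ and $\varphi \circ \psi \rhd^* \pi$. (D) If $\varphi \in \Pi_{k+1}$ and $\psi \in \Sigma_{k+1}$, then there are $\sigma \in \Sigma_{k+2}$ and $\pi \in \Pi_{k+2}$ with $\varphi \circ \psi \rhd^* \sigma$ and $\varphi \circ \psi \rhd^* \pi$. (E) If $\varphi \in \Sigma_{k+1}^+$, $\psi \in \Pi_{k+1}^+$ and $k+1 = \max\{\deg(\varphi), \deg(\psi)\}$, then there is $\pi \in \Pi_{k+1}$ with $(\varphi \to \psi) \rhd^* \pi$. (F) If $\varphi \in \Pi_{k+1}^+$, $\psi \in \Sigma_{k+1}^+$ and $k+1 = \max\{\deg(\varphi), \deg(\psi)\}$, then there is $\sigma \in \Sigma_{k+1}$ with $(\varphi \to \psi) \rhd^* \sigma$. (G) If $\varphi,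 \psi \in \Sigma_{k+1}$, then there are $\sigma \in \Sigma_{k+2}$ and $\pi \in \Pi_{k+2}$ with $(\varphi \to \psi) \rhd^* \sigma$ and $(\varphi \to \psi) \rhd^* \pi$. (H) If $\varphi, \psi \in \Pi_{k+1}$, then there are $\sigma \in \Sigma_{k+2}$ and $\pi \in \Pi_{k+2}$ with $(\varphi \to \psi) \rhd^* \sigma$ and $(\varphi \to \psi) \rhd^* \pi$.
   Context: Fix an arbitrary first-order language whose logical symbols are $\forall, \exists, \to, \land, \lor, \perp$; $\mathrm{FV}(\varphi)$ is the set of free variables of $\varphi$. Prenex classes: $\Sigma_0 = \Pi_0$ is the class of quantifier-free formulas; $\Sigma_{k+1}$ is the class of formulas $\exists x_1 \cdots \exists x_n \varphi$ with $n \geq 1$ and $\varphi \in \Pi_k$; $\Pi_{k+1}$ is the class of formulas $\forall x_1 \cdots \forall x_n \varphi$ with $n\ge 1$ and $\varphi \in \Sigma_k$. $\Sigma_k^+ = \Sigma_k \cup \bigcup_{i<k}(\Sigma_i \cup \Pi_i)$, $\Pi_k^+ = \Pi_k \cup \bigcup_{i<k}(\Sigma_i \cup \Pi_i)$. Degree: alternation paths are finite sequences of $+$ and $-$ in which $+$ and $-$ alternate; for such $s$, $i(s)$ is its first symbol if $s$ is nonempty and a special symbol $\times$ if $s=\langle\,\rangle$; $s^\perp$ swaps $+$ and $-$; $l(s)$ is its length; $+s$, $-s$ denote prepending. $\mathrm{Alt}(\varphi)$: if $\varphi$ is quantifier-free, $\{\langle\,\rangle\}$; otherwise $\mathrm{Alt}(\varphi_1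 \land \varphi_2)=\mathrm{Alt}(\varphi_1 \lor \varphi_2) = \mathrm{Alt}(\varphi_1)\cup\mathrm{Alt}(\varphi_2)$; $\mathrm{Alt}(\varphi_1\to\varphi_2) = \{s^\perp : s\in\mathrm{Alt}(\varphi_1)\}\cup\mathrm{Alt}(\varphi_2)$; $\mathrm{Alt}(\forall x\varphi_1) = \{s\in\mathrm{Alt}(\varphi_1): i(s)=-\}\cup\{ -s: s\in\mathrm{Alt}(\varphi_1), i(s)\neq -\}$; $\mathrm{Alt}(\exists x\varphi_1) = \{s\in\mathrm{Alt}(\varphi_1): i(s)=+\}\cup\{+s: s\in\mathrm{Alt}(\varphi_1), i(s)\neq +\}$. $\deg(\varphi)=\max\{l(s): s\in\mathrm{Alt}(\varphi)\}$. Prenex transformation: $\varphi\rhd\psi$ means that for some formulas $\xi,\delta$, a variable $x\notin\mathrm{FV}(\delta)$, a variable $y$ not occurring in $\xi$, and $Q\in\{\forall,\exists\}$, $(\varphi,\psi)$ is one of: $(\exists x\xi(x)\to\delta, \forall x(\xi(x)\to\delta))$; $(\forall x\xi(x)\to\delta, \exists x(\xi(x)\to\delta))$; $(\delta\to Qx\,\xi(x), Qx(\delta\to\xi(x)))$; $(Qx\,\xi(x)\land\delta, Qx(\xi(x)\land\delta))$; $(\delta\land Qx\,\xi(x), Qx(\delta\land\xi(x)))$; $(Qx\,\xi(x)\lor\delta, Qx(\xi(x)\lor\delta))$; $(\delta\lor Qx\,\xi(x), Qx(\delta\lor\xi(x)))$; $(Qx\,\xi(x), Qy\,\xi(y))$,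 with $\xi(y)$ the substitution of $y$ for free $x$. $\varphi\rhd^*\psi$ means there are $m\ge0$ and $\varphi_0\equiv\varphi,\dots,\varphi_m\equiv\psi$ with each $\varphi_{i+1}$ obtained from $\varphi_i$ by replacing one occurrence of a subformula $\xi_i$ with $\delta_i$ where $\xi_i\rhd\delta_i$. -}

module Defs where

open import Data.Nat using (ℕ; zero; suc; _≤_; _<_; _⊔_)
open import Data.Nat.Properties using (_≟_)
open import Data.Bool using (Bool; true; false; _∧_; if_then_else_)
open import Data.List using (List; []; _∷_; _++_; [_]; map; length; filter; foldr)
open import Data.List.Membership.Propositional using (_∉_)
open import Data.Vec using (Vec; []; _∷_)
open import Data.Product using (Σ; _×_; ∃-syntax)
open import Data.Sum using (_⊎_)
open import Relation.Nullary using (¬?; yes; no)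
open import Relation.Binary.PropositionalEquality using (_≡_)
open import Relation.Binary.Construct.Closure.ReflexiveTransitive using (Star)

record Signature : Set₁ where
  field
    Func      : Set
    funArity  : Func → ℕ
    Pred      : Set
    predArity : Pred → ℕ

module Syntax (L : Signature) where
  open Signature L

  Var : Set
  Var = ℕ

  data Term : Set where
    var : Var → Term
    fun : (f : Func) → Vec Term (funArity f) → Term

  infixr 5 _⇒'_
  infixr 6 _∨'_
  infixr 7 _∧'_
  data Formula : Set where
    atom   : (P : Pred) → Vec Term (predArity P) → Formula
    falsum : Formula
    _∧'_   : Formula → Formula → Formula
    _∨'_   : Formula → Formula → Formula
    _⇒'_   : Formula → Formula → Formula
    ∀'     : Var → Formula → Formula
    ∃'     : Var → Formula → Formula

  termVars  : Term → List Var
  termsVars : ∀ {n} → Vec Term n → List Var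
  termVars (var x)    = x ∷ []
  termVars (fun f ts) = termsVars ts
  termsVars []       = []
  termsVars (t ∷ ts) = termVars t ++ termsVars ts

  FV : Formula → List Var
  FV (atom P ts) = termsVars ts
  FV falsum      = []
  FV (φ ∧' ψ)    = FV φ ++ FV ψ
  FV (φ ∨' ψ)    = FV φ ++ FV ψ
  FV (φ ⇒' ψ)    = FV φ ++ FV ψ
  FV (∀' x φ)    = filter (λ y → ¬? (y ≟ x)) (FV φ)
  FV (∃' x φ)    = filter (λ y → ¬? (y ≟ x)) (FV φ)

  Vars : Formula → List Var
  Vars (atom P ts) = termsVars ts
  Vars falsum      = []
  Vars (φ ∧' ψ)    = Vars φ ++ Vars ψ
  Vars (φ ∨' ψ)    = Vars φ ++ Vars ψ
  Vars (φ ⇒' ψ)    = Vars φ ++ Vars ψ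
  Vars (∀' x φ)    = x ∷ Vars φ
  Vars (∃' x φ)    = x ∷ Vars φ

  substT  : Var → Var → Term → Term
  substTs : ∀ {n} → Var → Var → Vec Term n → Vec Term n
  substT y x (var z) with z ≟ x
  ... | yes _ = var y
  ... | no  _ = var z
  substT y x (fun f ts) = fun f (substTs y x ts)
  substTs y x []       = []
  substTs y x (t ∷ ts) = substT y x t ∷ substTs y x ts

  subst : Var → Var → Formula → Formula
  subst y x (atom P ts) = atom P (substTs y x ts)
  subst y x falsum      = falsum
  subst y x (φ ∧' ψ)    = subst y x φ ∧' subst y x ψ
  subst y x (φ ∨' ψ)    = subst y x φ ∨' subst y x ψ
  subst y x (φ ⇒' ψ)    = subst y x φ ⇒' subst y x ψ
  subst y x (∀' z φ) with z ≟ x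
  ... | yes _ = ∀' z φ
  ... | no  _ = ∀' z (subst y x φ)
  subst y x (∃' z φ) with z ≟ x
  ... | yes _ = ∃' z φ
  ... | no  _ = ∃' z (subst y x φ)

  isQF : Formula → Bool
  isQF (atom P ts) = true
  isQF falsum      = true
  isQF (φ ∧' ψ)    = isQF φ ∧ isQF ψ
  isQF (φ ∨' ψ)    = isQF φ ∧ isQF ψ
  isQF (φ ⇒' ψ)    = isQF φ ∧ isQF ψ
  isQF (∀' x φ)    = false
  isQF (∃' x φ)    = false

  QF : Formula → Set
  QF φ = isQF φ ≡ true

  exs : List Var → Formula → Formula
  exs []       φ = φ
  exs (x ∷ xs) φ = ∃' x (exs xs φ)

  alls : List Var → Formula → Formula
  alls []       φ = φ
  alls (x ∷ xs) φ = ∀' x (alls xs φ)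

  InΣ : ℕ → Formula → Set
  InΠ : ℕ → Formula → Set
  InΣ zero    φ = QF φ
  InΣ (suc k) φ = ∃[ xs ] ∃[ ψ ] (1 ≤ length xs × φ ≡ exs xs ψ × InΠ k ψ)
  InΠ zero    φ = QF φ
  InΠ (suc k) φ = ∃[ xs ] ∃[ ψ ] (1 ≤ length xs × φ ≡ alls xs ψ × InΣ k ψ)

  InΣ⁺ : ℕ → Formula → Set
  InΣ⁺ k φ = InΣ k φ ⊎ ∃[ i ] (i < k × (InΣ i φ ⊎ InΠ i φ))

  InΠ⁺ : ℕ → Formula → Set
  InΠ⁺ k φ = InΠ k φ ⊎ ∃[ i ] (i < k × (InΣ i φ ⊎ InΠ i φ))

  data Sign : Set where
    plus minus : Sign

  swap : Sign → Sign
  swap plus  = minus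
  swap minus = plus

  perp : List Sign → List Sign
  perp = map swap

  addMinus : List Sign → List Sign
  addMinus []           = minus ∷ []
  addMinus (minus ∷ s)  = minus ∷ s
  addMinus (plus ∷ s)   = minus ∷ plus ∷ s

  addPlus : List Sign → List Sign
  addPlus []           = plus ∷ []
  addPlus (plus ∷ s)   = plus ∷ s
  addPlus (minus ∷ s)  = plus ∷ minus ∷ s

  -- Alt(φ) as a finite list (representing a finite set)
  Alt  : Formula → List (List Sign)
  Alt' : Formula → List (List Sign)
  Alt φ = if isQF φ then [ [] ] else Alt' φ
  Alt' (atom P ts) = [ [] ]
  Alt' falsum      = [ [] ]
  Alt' (φ ∧' ψ)    = Alt φ ++ Alt ψ
  Alt' (φ ∨' ψ)    = Alt φ ++ Alt ψ
  Alt' (φ ⇒' ψ)    = map perp (Alt φ) ++ Alt ψ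
  Alt' (∀' x φ)    = map addMinus (Alt φ)
  Alt' (∃' x φ)    = map addPlus (Alt φ)

  deg : Formula → ℕ
  deg φ = foldr (λ s m → length s ⊔ m) 0 (Alt φ)

  data Quant : Set where
    all ex : Quant

  quant : Quant → Var → Formula → Formula
  quant all x φ = ∀' x φ
  quant ex  x φ = ∃' x φ

  infix 4 _▷_
  data _▷_ : Formula → Formula → Set where
    ex⇒  : ∀ {x ξ δ} → x ∉ FV δ → (∃' x ξ ⇒' δ) ▷ ∀' x (ξ ⇒' δ)
    all⇒ : ∀ {x ξ δ} → x ∉ FV δ → (∀' x ξ ⇒' δ) ▷ ∃' x (ξ ⇒' δ)
    ⇒Q   : ∀ {Q x ξ δ} → x ∉ FV δ → (δ ⇒' quant Q x ξ) ▷ quant Q x (δ ⇒' ξ)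
    Q∧   : ∀ {Q x ξ δ} → x ∉ FV δ → (quant Q x ξ ∧' δ) ▷ quant Q x (ξ ∧' δ)
    ∧Q   : ∀ {Q x ξ δ} → x ∉ FV δ → (δ ∧' quant Q x ξ) ▷ quant Q x (δ ∧' ξ)
    Q∨   : ∀ {Q x ξ δ} → x ∉ FV δ → (quant Q x ξ ∨' δ) ▷ quant Q x (ξ ∨' δ)
    ∨Q   : ∀ {Q x ξ δ} → x ∉ FV δ → (δ ∨' quant Q x ξ) ▷ quant Q x (δ ∨' ξ)
    ren  : ∀ {Q x y ξ} → y ∉ Vars ξ → quant Q x ξ ▷ quant Q y (subst y x ξ)

  data Step : Formula → Formula → Set where
    here : ∀ {φ ψ} → φ ▷ ψ → Step φ ψ
    ∧ˡ   : ∀ {φ φ' ψ} → Step φ φ' → Step (φ ∧' ψ) (φ' ∧' ψ)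
    ∧ʳ   : ∀ {φ ψ ψ'} → Step ψ ψ' → Step (φ ∧' ψ) (φ ∧' ψ')
    ∨ˡ   : ∀ {φ φ' ψ} → Step φ φ' → Step (φ ∨' ψ) (φ' ∨' ψ)
    ∨ʳ   : ∀ {φ ψ ψ'} → Step ψ ψ' → Step (φ ∨' ψ) (φ ∨' ψ')
    ⇒ˡ   : ∀ {φ φ' ψ} → Step φ φ' → Step (φ ⇒' ψ) (φ' ⇒' ψ)
    ⇒ʳ   : ∀ {φ ψ ψ'} → Step ψ ψ' → Step (φ ⇒' ψ) (φ ⇒' ψ')
    ∀ᶜ   : ∀ {x φ φ'} → Step φ φ' → Step (∀' x φ) (∀' x φ')
    ∃ᶜ   : ∀ {x φ φ'} → Step φ φ' → Step (∃' x φ) (∃' x φ')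

  infix 4 _▷*_
  _▷*_ : Formula → Formula → Set
  _▷*_ = Star Step

  data Conn : Set where
    conj disj : Conn

  _⟨_⟩_ : Formula → Conn → Formula → Formula
  φ ⟨ conj ⟩ ψ = φ ∧' ψ
  φ ⟨ disj ⟩ ψ = φ ∨' ψ

-- A prenex formula pre p χ is described by its quantifier word (the quantifiers of p in order)
-- and its quantifier-free matrix χ; its degree is the number of maximal alternating blocks of
-- that word, which is also what places it in Σ_k or Π_k.  Once the bound variables of φ and ψ
-- are renamed apart, the rules ▷ pull the quantifiers out of φ ∘ ψ (or φ → ψ) in any order
-- that interleaves the two quantifier words, the quantifiers of the antecedent of → being
-- dualised.  Every clause thus reduces to a fact about interleaving words: a word with exactly
-- k+1 blocks starting with Q absorbs any word fitting into that block pattern without new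
-- blocks, and two words of k+1 blocks starting with opposite quantifiers interleave into k+2
-- blocks starting with either quantifier.  In (A), (B), (E), (F) the degree hypothesis ensures
-- that one of the two words has exactly k+1 blocks.

module Submission where

open import Defs
open import Data.Nat using (ℕ; zero; suc; _≤_; _<_; _⊔_; z≤n; s≤s)
open import Data.Nat.Properties using (<-irrefl; <⇒≤; n≤1+n; ⊔-lub; ⊔-identityʳ; _≟_)
open import Data.Bool using (_∧_; if_then_else_)
open import Data.List using (List; []; _∷_; _++_; [_]; map; length; foldr)
open import Data.List.Extrema.Nat using (max; xs≤max)
open import Data.List.Membership.Propositional using (_∈_; _∉_)
open import Data.List.Membership.Propositional.Properties using (∈-++⁺ˡ; ∈-++⁺ʳ; ∈-++⁻)
open import Data.List.Relation.Binary.Pointwise using (≡⇒Pointwise-≡)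
open import Data.List.Relation.Binary.Subset.Propositional using (_⊆_)
open import Data.List.Relation.Binary.Subset.Propositional.Properties
  using (⊆-refl; ⊆-trans; ⊆-reflexive; xs⊆x∷xs; ∷⁺ʳ; xs⊆xs++ys; xs⊆ys++xs; ++⁺; filter-⊆)
open import Data.List.Relation.Ternary.Interleaving.Propositional
  using (Interleaving; []; consˡ; consʳ; left; swap)
open import Data.List.Relation.Unary.All as All using (All; []; _∷_; lookup; tabulate)
open import Data.List.Relation.Unary.Any using (here; there)
open import Data.Product as Product using (_×_; _,_; proj₁; proj₂; ∃-syntax)
open import Data.Sum using (_⊎_; inj₁; inj₂)
open import Data.Empty using (⊥-elim)
open import Data.Vec using (Vec; []; _∷_)
open import Function using (_∘_)
open import Relation.Binary.Construct.Closure.ReflexiveTransitive using (ε; _◅_; _◅◅_; gmap)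
open import Relation.Binary.PropositionalEquality using (_≡_; _≢_; refl; sym; trans; cong; cong₂)
import Relation.Binary.PropositionalEquality as ≡
open import Relation.Nullary using (yes; no; ¬?)

module PrenexNormalisation (L : Signature) where
  open Syntax L hiding (swap)

  dual : Quant → Quant
  dual all = ex
  dual ex  = all

  In : Quant → ℕ → Formula → Set
  In ex  = InΣ
  In all = InΠ

  In⁺ : Quant → ℕ → Formula → Set
  In⁺ Q k φ = In Q k φ ⊎ ∃[ i ] (i < k × (InΣ i φ ⊎ InΠ i φ))

  private variable
    Q Q′ : Quant
    i k m n : ℕ
    u v : List Quant
    x y z : Var
    φ ψ χ θ : Formula
    U V W : List Quant → Set

  -- Blocks Q k u: u consists of exactly k maximal blocks of equal quantifiers, starting with Q.
  -- Fits Q m u: u can be cut into m possibly empty blocks with quantifiers Q, dual Q, Q, ….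
  data Blocks : Quant → ℕ → List Quant → Set where
    []     : Blocks Q 0 []
    extend : Blocks Q (suc k) u → Blocks Q (suc k) (Q ∷ u)
    switch : Blocks (dual Q) k u → Blocks Q (suc k) (Q ∷ u)

  data Fits : Quant → ℕ → List Quant → Set where
    []     : Fits Q m []
    extend : Fits Q (suc m) u → Fits Q (suc m) (Q ∷ u)
    skip   : Fits (dual Q) m u → Fits Q (suc m) u

  Blocks⇒Fits : Blocks Q k u → Fits Q k u
  Blocks⇒Fits []         = []
  Blocks⇒Fits (extend b) = extend (Blocks⇒Fits b)
  Blocks⇒Fits (switch b) = extend (skip (Blocks⇒Fits b))

  Fits-mono : m ≤ n → Fits Q m u → Fits Q n u
  Fits-mono _       []         = []
  Fits-mono (s≤s l) (extend f) = extend (Fits-mono (s≤s l) f)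
  Fits-mono (s≤s l) (skip f)   = skip (Fits-mono l f)

  Blocks⇒Fits-< : ∀ Q → i < m → Blocks Q′ i u → Fits Q m u
  Blocks⇒Fits-< {Q′ = all} all i<m     b = Fits-mono (<⇒≤ i<m) (Blocks⇒Fits b)
  Blocks⇒Fits-< {Q′ = ex}  ex  i<m     b = Fits-mono (<⇒≤ i<m) (Blocks⇒Fits b)
  Blocks⇒Fits-< {Q′ = ex}  all (s≤s l) b = skip (Fits-mono l (Blocks⇒Fits b))
  Blocks⇒Fits-< {Q′ = all} ex  (s≤s l) b = skip (Fits-mono l (Blocks⇒Fits b))

  module _ {f : Quant → Quant} (f-dual : ∀ Q → f (dual Q) ≡ dual (f Q)) where

    Blocks-map : Blocks Q k u → Blocks (f Q) k (map f u)
    Blocks-map []                 = []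
    Blocks-map (extend b)         = extend (Blocks-map b)
    Blocks-map (switch {Q = Q} b) = switch (≡.subst (λ R → Blocks R _ _) (f-dual Q) (Blocks-map b))

    Fits-map : Fits Q m u → Fits (f Q) m (map f u)
    Fits-map []               = []
    Fits-map (extend b)       = extend (Fits-map b)
    Fits-map (skip {Q = Q} b) = skip (≡.subst (λ R → Fits R _ _) (f-dual Q) (Fits-map b))

  Merge : (List Quant → Set) → List Quant → List Quant → Set
  Merge W u v = ∃[ w ] (Interleaving u v w × W w)

  merge-Blocks-Fits : Blocks Q m u → Fits Q m v → Merge (Blocks Q m) u v
  merge-Blocks-Fits [] [] = [] , [] , []
  merge-Blocks-Fits (extend b) f with merge-Blocks-Fits b f
  ... | _ , I , b′ = _ , consˡ I , extend b′
  merge-Blocks-Fits b@(switch _) [] = _ , left (≡⇒Pointwise-≡ refl) , b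
  merge-Blocks-Fits b@(switch _) (extend f) with merge-Blocks-Fits b f
  ... | _ , I , b′ = _ , consʳ I , extend b′
  merge-Blocks-Fits (switch b) (skip f) with merge-Blocks-Fits b f
  ... | _ , I , b′ = _ , consˡ I , switch b′

  merge-swap : Merge W u v → Merge W v u
  merge-swap = Product.map₂ (Product.map₁ swap)

  merge-Fits-Blocks : Fits Q m u → Blocks Q m v → Merge (Blocks Q m) u v
  merge-Fits-Blocks f b = merge-swap (merge-Blocks-Fits b f)

  -- The first block of u goes in front; the remaining k blocks of u fit into the k+1 of v.
  merge-alternating : Blocks Q (suc k) u → Blocks (dual Q) (suc k) v → Merge (Blocks Q (suc (suc k))) u v
  merge-alternating (extend b) b′ with merge-alternating b b′
  ... | _ , I , b″ = _ , consˡ I , extend b″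
  merge-alternating {k = k} (switch b) b′ with merge-Fits-Blocks (Fits-mono (n≤1+n k) (Blocks⇒Fits b)) b′
  ... | _ , I , b″ = _ , consˡ I , switch b″

  merge-opposite : ∀ R → Blocks Q (suc k) u → Blocks (dual Q) (suc k) v →
                   Merge (Blocks R (suc (suc k))) u v
  merge-opposite {Q = all} all b b′ = merge-alternating b b′
  merge-opposite {Q = ex}  ex  b b′ = merge-alternating b b′
  merge-opposite {Q = ex}  all b b′ = merge-swap (merge-alternating b′ b)
  merge-opposite {Q = all} ex  b b′ = merge-swap (merge-alternating b′ b)

  Prefix : Set
  Prefix = List (Quant × Var)

  pre : Prefix → Formula → Formula
  pre []            χ = χ
  pre ((Q , x) ∷ p) χ = quant Q x (pre p χ)

  quants : Prefix → List Quant
  quants = map proj₁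

  boundVars : Prefix → List Var
  boundVars = map proj₂

  data Prenex (P : List Quant → Set) : Formula → Set where
    prenex : ∀ p {χ} → QF χ → P (quants p) → Prenex P (pre p χ)

  Prenex-map : (∀ {u} → U u → V u) → Prenex U φ → Prenex V φ
  Prenex-map f (prenex p qχ h) = prenex p qχ (f h)

  quant-prenex : ∀ Q x → Prenex (U ∘ (Q ∷_)) φ → Prenex U (quant Q x φ)
  quant-prenex Q x (prenex p qχ h) = prenex ((Q , x) ∷ p) qχ h

  exs-prenex : ∀ xs → 1 ≤ length xs → Prenex (Blocks all k) φ → Prenex (Blocks ex (suc k)) (exs xs φ)
  exs-prenex (x ∷ [])     _ h = quant-prenex ex x (Prenex-map switch h)
  exs-prenex (x ∷ y ∷ xs) _ h = quant-prenex ex x (Prenex-map extend (exs-prenex (y ∷ xs) (s≤s z≤n) h))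

  alls-prenex : ∀ xs → 1 ≤ length xs → Prenex (Blocks ex k) φ → Prenex (Blocks all (suc k)) (alls xs φ)
  alls-prenex (x ∷ [])     _ h = quant-prenex all x (Prenex-map switch h)
  alls-prenex (x ∷ y ∷ xs) _ h = quant-prenex all x (Prenex-map extend (alls-prenex (y ∷ xs) (s≤s z≤n) h))

  In⇒Prenex : ∀ Q k → In Q k φ → Prenex (Blocks Q k) φ
  In⇒Prenex ex  zero    qφ                      = prenex [] qφ []
  In⇒Prenex all zero    qφ                      = prenex [] qφ []
  In⇒Prenex ex  (suc k) (xs , _ , 1≤ , refl , h) = exs-prenex xs 1≤ (In⇒Prenex all k h)
  In⇒Prenex all (suc k) (xs , _ , 1≤ , refl , h) = alls-prenex xs 1≤ (In⇒Prenex ex k h)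

  Prenex⇒In : ∀ Q k → Prenex (Blocks Q k) φ → In Q k φ
  Prenex⇒In Q k (prenex p {χ} qχ b) = go Q k p b
    where
      go : ∀ Q k p → Blocks Q k (quants p) → In Q k (pre p χ)
      go ex  zero [] [] = qχ
      go all zero [] [] = qχ
      go ex (suc k) ((_ , x) ∷ p) (extend b) with go ex (suc k) p b
      ... | xs , ψ , _ , eq , h = x ∷ xs , ψ , s≤s z≤n , cong (∃' x) eq , h
      go all (suc k) ((_ , x) ∷ p) (extend b) with go all (suc k) p b
      ... | xs , ψ , _ , eq , h = x ∷ xs , ψ , s≤s z≤n , cong (∀' x) eq , h
      go ex  (suc k) ((_ , x) ∷ p) (switch b) = x ∷ [] , pre p χ , s≤s z≤n , refl , go all k p b
      go all (suc k) ((_ , x) ∷ p) (switch b) = x ∷ [] , pre p χ , s≤s z≤n , refl , go ex k p b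

  addSign : Quant → List Sign → List Sign
  addSign all = addMinus
  addSign ex  = addPlus

  sign : Quant → Sign
  sign all = minus
  sign ex  = plus

  alternating : Quant → ℕ → List Sign
  alternating Q zero    = []
  alternating Q (suc k) = sign Q ∷ alternating (dual Q) k

  length-alternating : ∀ Q k → length (alternating Q k) ≡ k
  length-alternating Q zero    = refl
  length-alternating Q (suc k) = cong suc (length-alternating (dual Q) k)

  addSign-alternating : ∀ Q k → addSign Q (alternating Q (suc k)) ≡ alternating Q (suc k)
  addSign-alternating all k = refl
  addSign-alternating ex  k = refl

  addSign-dual-alternating : ∀ Q k → addSign Q (alternating (dual Q) k) ≡ alternating Q (suc k)
  addSign-dual-alternating all zero    = refl
  addSign-dual-alternating all (suc k) = refl
  addSign-dual-alternating ex  zero    = refl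
  addSign-dual-alternating ex  (suc k) = refl

  altPath : List Quant → List Sign
  altPath = foldr addSign []

  altPath-Blocks : Blocks Q k u → altPath u ≡ alternating Q k
  altPath-Blocks []                 = refl
  altPath-Blocks (extend {Q = Q} b) = trans (cong (addSign Q) (altPath-Blocks b)) (addSign-alternating Q _)
  altPath-Blocks (switch {Q = Q} b) = trans (cong (addSign Q) (altPath-Blocks b)) (addSign-dual-alternating Q _)

  Alt-quant : ∀ Q x φ → Alt (quant Q x φ) ≡ map (addSign Q) (Alt φ)
  Alt-quant all x φ = refl
  Alt-quant ex  x φ = refl

  Alt-pre : ∀ p → QF χ → Alt (pre p χ) ≡ [ altPath (quants p) ]
  Alt-pre {χ} []            qχ = cong (λ b → if b then [ [] ] else Alt' χ) qχ
  Alt-pre {χ} ((Q , x) ∷ p) qχ = trans (Alt-quant Q x (pre p χ)) (cong (map (addSign Q)) (Alt-pre p qχ))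

  deg-Prenex : Prenex (Blocks Q k) φ → deg φ ≡ k
  deg-Prenex {Q} {k} (prenex p {χ} qχ b) = begin
    deg (pre p χ)                      ≡⟨ cong (foldr (λ s m → length s ⊔ m) 0) (Alt-pre p qχ) ⟩
    length (altPath (quants p)) ⊔ 0    ≡⟨ ⊔-identityʳ _ ⟩
    length (altPath (quants p))        ≡⟨ cong length (altPath-Blocks b) ⟩
    length (alternating Q k)           ≡⟨ length-alternating Q k ⟩
    k                                  ∎
    where open ≡.≡-Reasoning

  Prenex-fewer-blocks : ∀ Q → i < m → Prenex (Blocks Q′ i) φ → Prenex (Fits Q m) φ × deg φ < m
  Prenex-fewer-blocks Q i<m h = Prenex-map (Blocks⇒Fits-< Q i<m) h , ≡.subst (_< _) (sym (deg-Prenex h)) i<m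

  In⁺⇒Prenex : ∀ Q → In⁺ Q m φ → Prenex (Blocks Q m) φ ⊎ (Prenex (Fits Q m) φ × deg φ < m)
  In⁺⇒Prenex Q (inj₁ h)                  = inj₁ (In⇒Prenex Q _ h)
  In⁺⇒Prenex Q (inj₂ (i , i<m , inj₁ h)) = inj₂ (Prenex-fewer-blocks Q i<m (In⇒Prenex ex i h))
  In⁺⇒Prenex Q (inj₂ (i , i<m , inj₂ h)) = inj₂ (Prenex-fewer-blocks Q i<m (In⇒Prenex all i h))

  In⁺-exact-side : ∀ Q Q′ → In⁺ Q m φ → In⁺ Q′ m ψ → m ≡ deg φ ⊔ deg ψ →
                   (Prenex (Blocks Q m) φ × Prenex (Fits Q′ m) ψ) ⊎
                   (Prenex (Fits Q m) φ × Prenex (Blocks Q′ m) ψ)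
  In⁺-exact-side Q Q′ hφ hψ m≡ with In⁺⇒Prenex Q hφ | In⁺⇒Prenex Q′ hψ
  ... | inj₁ bφ       | inj₁ bψ       = inj₁ (bφ , Prenex-map Blocks⇒Fits bψ)
  ... | inj₁ bφ       | inj₂ (fψ , _) = inj₁ (bφ , fψ)
  ... | inj₂ (fφ , _) | inj₁ bψ       = inj₂ (fφ , bψ)
  ... | inj₂ (_ , φ<) | inj₂ (_ , ψ<) = ⊥-elim (<-irrefl (sym m≡) (⊔-lub φ< ψ<))

  FV-quant⊆ : ∀ Q x φ → FV (quant Q x φ) ⊆ FV φ
  FV-quant⊆ all x φ = filter-⊆ (λ y → ¬? (y ≟ x)) (FV φ)
  FV-quant⊆ ex  x φ = filter-⊆ (λ y → ¬? (y ≟ x)) (FV φ)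

  FV-pre⊆ : ∀ p χ → FV (pre p χ) ⊆ FV χ
  FV-pre⊆ []            χ = ⊆-refl
  FV-pre⊆ ((Q , x) ∷ p) χ = ⊆-trans (FV-quant⊆ Q x (pre p χ)) (FV-pre⊆ p χ)

  FV⊆Vars : ∀ φ → FV φ ⊆ Vars φ
  FV⊆Vars (atom P ts) = ⊆-refl
  FV⊆Vars falsum      = ⊆-refl
  FV⊆Vars (φ ∧' ψ)    = ++⁺ (FV⊆Vars φ) (FV⊆Vars ψ)
  FV⊆Vars (φ ∨' ψ)    = ++⁺ (FV⊆Vars φ) (FV⊆Vars ψ)
  FV⊆Vars (φ ⇒' ψ)    = ++⁺ (FV⊆Vars φ) (FV⊆Vars ψ)
  FV⊆Vars (∀' x φ)    = ⊆-trans (FV-quant⊆ all x φ) (⊆-trans (FV⊆Vars φ) (xs⊆x∷xs _ x))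
  FV⊆Vars (∃' x φ)    = ⊆-trans (FV-quant⊆ ex x φ) (⊆-trans (FV⊆Vars φ) (xs⊆x∷xs _ x))

  Vars-quant : ∀ Q x φ → Vars (quant Q x φ) ≡ x ∷ Vars φ
  Vars-quant all x φ = refl
  Vars-quant ex  x φ = refl

  Vars-pre : ∀ p χ → Vars (pre p χ) ≡ boundVars p ++ Vars χ
  Vars-pre []            χ = refl
  Vars-pre ((Q , x) ∷ p) χ = trans (Vars-quant Q x (pre p χ)) (cong (x ∷_) (Vars-pre p χ))

  boundVars⊆Vars-pre : ∀ p χ → boundVars p ⊆ Vars (pre p χ)
  boundVars⊆Vars-pre p χ = ⊆-trans (xs⊆xs++ys _ _) (⊆-reflexive (sym (Vars-pre p χ)))

  Vars⊆Vars-pre : ∀ p χ → Vars χ ⊆ Vars (pre p χ)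
  Vars⊆Vars-pre p χ = ⊆-trans (xs⊆ys++xs _ _) (⊆-reflexive (sym (Vars-pre p χ)))

  subst-quant : ∀ Q → z ≢ x → subst y x (quant Q z φ) ≡ quant Q z (subst y x φ)
  subst-quant {z} {x} all z≢x with z ≟ x
  ... | yes z≡x = ⊥-elim (z≢x z≡x)
  ... | no  _   = refl
  subst-quant {z} {x} ex  z≢x with z ≟ x
  ... | yes z≡x = ⊥-elim (z≢x z≡x)
  ... | no  _   = refl

  subst-pre : ∀ p → x ∉ boundVars p → subst y x (pre p χ) ≡ pre p (subst y x χ)
  subst-pre []            _   = refl
  subst-pre ((Q , z) ∷ p) x∉p =
    trans (subst-quant Q (λ z≡x → x∉p (here (sym z≡x)))) (cong (quant Q z) (subst-pre p (x∉p ∘ there)))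

  qf-subst : ∀ φ → isQF (subst y x φ) ≡ isQF φ
  qf-subst (atom P ts) = refl
  qf-subst falsum      = refl
  qf-subst (φ ∧' ψ)    = cong₂ _∧_ (qf-subst φ) (qf-subst ψ)
  qf-subst (φ ∨' ψ)    = cong₂ _∧_ (qf-subst φ) (qf-subst ψ)
  qf-subst (φ ⇒' ψ)    = cong₂ _∧_ (qf-subst φ) (qf-subst ψ)
  qf-subst {x = x} (∀' z φ) with z ≟ x
  ... | yes _ = refl
  ... | no  _ = refl
  qf-subst {x = x} (∃' z φ) with z ≟ x
  ... | yes _ = refl
  ... | no  _ = refl

  private
    ++⁺-∷ : ∀ {as as′ bs bs′ : List Var} → as′ ⊆ y ∷ as → bs′ ⊆ y ∷ bs → as′ ++ bs′ ⊆ y ∷ (as ++ bs)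
    ++⁺-∷ {as′ = as′} f g h with ∈-++⁻ as′ h
    ... | inj₁ a = ∷⁺ʳ _ (xs⊆xs++ys _ _) (f a)
    ... | inj₂ b = ∷⁺ʳ _ (xs⊆ys++xs _ _) (g b)

    ∷⁺-∷ : ∀ {as as′ : List Var} → as′ ⊆ y ∷ as → z ∷ as′ ⊆ y ∷ z ∷ as
    ∷⁺-∷ f (here e)  = there (here e)
    ∷⁺-∷ f (there h) with f h
    ... | here e  = here e
    ... | there h′ = there (there h′)

  vars-substT : ∀ t → termVars (substT y x t) ⊆ y ∷ termVars t
  vars-substTs : ∀ {n} (ts : Vec Term n) → termsVars (substTs y x ts) ⊆ y ∷ termsVars ts
  vars-substT {x = x} (var z) with z ≟ x
  ... | yes _ = λ { (here e) → here e }
  ... | no  _ = there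
  vars-substT (fun f ts) = vars-substTs ts
  vars-substTs []       ()
  vars-substTs (t ∷ ts) = ++⁺-∷ (vars-substT t) (vars-substTs ts)

  vars-subst : ∀ φ → Vars (subst y x φ) ⊆ y ∷ Vars φ
  vars-subst (atom P ts) = vars-substTs ts
  vars-subst falsum      ()
  vars-subst (φ ∧' ψ)    = ++⁺-∷ (vars-subst φ) (vars-subst ψ)
  vars-subst (φ ∨' ψ)    = ++⁺-∷ (vars-subst φ) (vars-subst ψ)
  vars-subst (φ ⇒' ψ)    = ++⁺-∷ (vars-subst φ) (vars-subst ψ)
  vars-subst {x = x} (∀' z φ) with z ≟ x
  ... | yes _ = xs⊆x∷xs _ _
  ... | no  _ = ∷⁺-∷ (vars-subst φ)
  vars-subst {x = x} (∃' z φ) with z ≟ x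
  ... | yes _ = xs⊆x∷xs _ _
  ... | no  _ = ∷⁺-∷ (vars-subst φ)

  fresh : List Var → Var
  fresh xs = suc (max 0 xs)

  fresh-∉ : ∀ xs → fresh xs ∉ xs
  fresh-∉ xs x∈xs = <-irrefl refl (lookup (xs≤max 0 xs) x∈xs)

  quant-cong : ∀ Q x → Step φ ψ → Step (quant Q x φ) (quant Q x ψ)
  quant-cong all x = ∀ᶜ
  quant-cong ex  x = ∃ᶜ

  record Renamed (A : List Var) (p : Prefix) (χ : Formula) : Set where
    constructor renamed
    field
      prefix       : Prefix
      matrix       : Formula
      same-quants  : quants prefix ≡ quants p
      same-isQF    : isQF matrix ≡ isQF χ
      bound-avoids : All (_∉ A) (boundVars prefix)
      matrix-vars  : Vars matrix ⊆ boundVars prefix ++ Vars χ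
      reduces      : pre p χ ▷* pre prefix matrix

  rename : ∀ A p χ → Renamed A p χ
  rename A []            χ = renamed [] χ refl refl [] ⊆-refl ε
  -- The inner prefix also avoids x, so that substituting for x passes through it.
  rename A ((Q , x) ∷ p) χ with rename (x ∷ A) p χ
  ... | renamed p₁ χ₁ same-quants same-isQF bound-avoids matrix-vars reduces =
    renamed ((Q , x′) ∷ p₁) (subst x′ x χ₁) (cong (Q ∷_) same-quants) (trans (qf-subst χ₁) same-isQF)
            (x′∉A ∷ All.map (_∘ there) bound-avoids) (⊆-trans (vars-subst χ₁) (∷⁺ʳ x′ matrix-vars))
            (gmap (quant Q x) (quant-cong Q x) reduces ◅◅ rename-x)
    where
      avoid : List Var
      avoid = A ++ Vars (pre p₁ χ₁)
      x′ : Var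
      x′ = fresh avoid
      x′∉A : x′ ∉ A
      x′∉A = fresh-∉ avoid ∘ ∈-++⁺ˡ
      x∉p₁ : x ∉ boundVars p₁
      x∉p₁ x∈p₁ = lookup bound-avoids x∈p₁ (here refl)
      rename-x : quant Q x (pre p₁ χ₁) ▷* quant Q x′ (pre p₁ (subst x′ x χ₁))
      rename-x = ≡.subst (λ ξ → quant Q x (pre p₁ χ₁) ▷* quant Q x′ ξ) (subst-pre p₁ x∉p₁)
                   (here (ren (fresh-∉ avoid ∘ ∈-++⁺ʳ A)) ◅ ε)

  Apart : Prefix → Formula → Prefix → Formula → Set
  Apart p χ q θ = All (_∉ FV θ) (boundVars p) × All (_∉ FV χ) (boundVars q)

  open Renamed using (prefix; matrix)

  renamed-apart : ∀ {p q} (q′ : Renamed (Vars (pre p χ)) q θ) →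
                  (p′ : Renamed (Vars (pre (prefix q′) (matrix q′))) p χ) →
                  Apart (prefix p′) (matrix p′) (prefix q′) (matrix q′)
  renamed-apart {χ} {p = p} (renamed q₁ θ₁ _ _ q-avoids _ _) (renamed p₁ χ₁ _ _ p-avoids χ-vars _) =
    All.map (λ z∉ → z∉ ∘ Vars⊆Vars-pre q₁ θ₁ ∘ FV⊆Vars θ₁) p-avoids , tabulate q₁∉χ₁
    where
      q₁∉χ₁ : z ∈ boundVars q₁ → z ∉ FV χ₁
      q₁∉χ₁ z∈q₁ z∈χ₁ with ∈-++⁻ (boundVars p₁) (χ-vars (FV⊆Vars χ₁ z∈χ₁))
      ... | inj₁ z∈p₁ = lookup p-avoids z∈p₁ (boundVars⊆Vars-pre q₁ θ₁ z∈q₁)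
      ... | inj₂ z∈χ  = lookup q-avoids z∈q₁ (Vars⊆Vars-pre p χ z∈χ)

  record Connective : Set where
    field
      _∙_            : Formula → Formula → Formula
      leftQuant      : Quant → Quant
      leftQuant-dual : ∀ Q → leftQuant (dual Q) ≡ dual (leftQuant Q)
      pullˡ          : ∀ {Q x ξ δ} → x ∉ FV δ → (quant Q x ξ ∙ δ) ▷ quant (leftQuant Q) x (ξ ∙ δ)
      pullʳ          : ∀ {Q x ξ δ} → x ∉ FV δ → (δ ∙ quant Q x ξ) ▷ quant Q x (δ ∙ ξ)
      ∙-QF           : ∀ {χ θ} → QF χ → QF θ → QF (χ ∙ θ)
      ∙-congˡ        : ∀ {φ φ′ ψ} → Step φ φ′ → Step (φ ∙ ψ) (φ′ ∙ ψ)
      ∙-congʳ        : ∀ {φ ψ ψ′} → Step ψ ψ′ → Step (φ ∙ ψ) (φ ∙ ψ′)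

  connective : Conn → Connective
  connective c = record
    { _∙_ = _⟨ c ⟩_ ; leftQuant = λ Q → Q ; leftQuant-dual = λ _ → refl
    ; pullˡ = pullˡ c ; pullʳ = pullʳ c ; ∙-QF = ∙-QF c ; ∙-congˡ = ∙-congˡ c ; ∙-congʳ = ∙-congʳ c }
    where
      pullˡ : ∀ c {Q x ξ δ} → x ∉ FV δ → (quant Q x ξ ⟨ c ⟩ δ) ▷ quant Q x (ξ ⟨ c ⟩ δ)
      pullˡ conj = Q∧
      pullˡ disj = Q∨
      pullʳ : ∀ c {Q x ξ δ} → x ∉ FV δ → (δ ⟨ c ⟩ quant Q x ξ) ▷ quant Q x (δ ⟨ c ⟩ ξ)
      pullʳ conj = ∧Q
      pullʳ disj = ∨Q
      ∙-QF : ∀ c {χ θ} → QF χ → QF θ → QF (χ ⟨ c ⟩ θ)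
      ∙-QF conj = cong₂ _∧_
      ∙-QF disj = cong₂ _∧_
      ∙-congˡ : ∀ c {φ φ′ ψ} → Step φ φ′ → Step (φ ⟨ c ⟩ ψ) (φ′ ⟨ c ⟩ ψ)
      ∙-congˡ conj = ∧ˡ
      ∙-congˡ disj = ∨ˡ
      ∙-congʳ : ∀ c {φ ψ ψ′} → Step ψ ψ′ → Step (φ ⟨ c ⟩ ψ) (φ ⟨ c ⟩ ψ′)
      ∙-congʳ conj = ∧ʳ
      ∙-congʳ disj = ∨ʳ

  implication : Connective
  implication = record
    { _∙_ = _⇒'_ ; leftQuant = dual ; leftQuant-dual = λ _ → refl
    ; pullˡ = pullˡ ; pullʳ = ⇒Q ; ∙-QF = cong₂ _∧_ ; ∙-congˡ = ⇒ˡ ; ∙-congʳ = ⇒ʳ }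
    where
      pullˡ : ∀ {Q x ξ δ} → x ∉ FV δ → (quant Q x ξ ⇒' δ) ▷ quant (dual Q) x (ξ ⇒' δ)
      pullˡ {all} = all⇒
      pullˡ {ex}  = ex⇒

  module _ (C : Connective) where
    open Connective C

    pull : ∀ p q {w} → All (_∉ FV θ) (boundVars p) → All (_∉ FV χ) (boundVars q) →
           Interleaving (map leftQuant (quants p)) (quants q) w →
           ∃[ r ] (quants r ≡ w × pre p χ ∙ pre q θ ▷* pre r (χ ∙ θ))
    pull [] [] _ _ [] = [] , refl , ε
    pull {χ = χ} p ((Q , x) ∷ q) p∉θ (x∉χ ∷ q∉χ) (consʳ I) with pull p q p∉θ q∉χ I
    ... | r , refl , red =
      (Q , x) ∷ r , refl ,
      here (pullʳ (x∉χ ∘ FV-pre⊆ p χ)) ◅ gmap (quant Q x) (quant-cong Q x) red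
    pull {θ = θ} ((Q , x) ∷ p) q (x∉θ ∷ p∉θ) q∉χ (consˡ I) with pull p q p∉θ q∉χ I
    ... | r , refl , red =
      (leftQuant Q , x) ∷ r , refl ,
      here (pullˡ (x∉θ ∘ FV-pre⊆ q θ)) ◅ gmap (quant (leftQuant Q) x) (quant-cong _ x) red

    prenex-∙ : Prenex U φ → Prenex V ψ → (∀ {u v} → U u → V v → Merge W (map leftQuant u) v) →
               ∃[ σ ] (Prenex W σ × φ ∙ ψ ▷* σ)
    prenex-∙ (prenex p {χ} qχ hu) (prenex q {θ} qθ hv) merge
      with rename (Vars (pre p χ)) q θ
    ... | q′@(renamed q₁ θ₁ q≡ qfθ _ _ q-reduces)
      with rename (Vars (pre q₁ θ₁)) p χ
    ... | p′@(renamed p₁ χ₁ p≡ qfχ _ _ p-reduces)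
      with merge hu hv
    ... | w , I , hw
      with renamed-apart q′ p′
    ... | p₁∉θ₁ , q₁∉χ₁
      with pull p₁ q₁ p₁∉θ₁ q₁∉χ₁
             (≡.subst₂ (λ u v → Interleaving (map leftQuant u) v w) (sym p≡) (sym q≡) I)
    ... | r , refl , pulled =
      pre r (χ₁ ∙ θ₁) , prenex r (∙-QF (trans qfχ qχ) (trans qfθ qθ)) hw ,
      gmap (pre p χ ∙_) ∙-congʳ q-reduces ◅◅ gmap (_∙ pre q₁ θ₁) ∙-congˡ p-reduces ◅◅ pulled

    prenex-∙-In : Prenex U φ → Prenex V ψ →
                  (∀ {u v} → U u → V v → Merge (Blocks Q k) (map leftQuant u) v) →
                  ∃[ σ ] (In Q k σ × φ ∙ ψ ▷* σ)
    prenex-∙-In {Q = Q} {k = k} hφ hψ merge =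
      Product.map₂ (Product.map₁ (Prenex⇒In Q k)) (prenex-∙ hφ hψ merge)

    ∙-prenex-same-class : ∀ Q φ ψ → In⁺ Q m φ → In⁺ (leftQuant Q) m ψ → m ≡ deg φ ⊔ deg ψ →
                    ∃[ σ ] (In (leftQuant Q) m σ × φ ∙ ψ ▷* σ)
    ∙-prenex-same-class Q φ ψ hφ hψ m≡ with In⁺-exact-side Q (leftQuant Q) hφ hψ m≡
    ... | inj₁ (bφ , fψ) = prenex-∙-In bφ fψ λ b f → merge-Blocks-Fits (Blocks-map leftQuant-dual b) f
    ... | inj₂ (fφ , bψ) = prenex-∙-In fφ bψ λ f b → merge-Fits-Blocks (Fits-map leftQuant-dual f) b

    ∙-prenex-opposite-classes : ∀ Q φ ψ → In Q (suc k) φ → In (dual (leftQuant Q)) (suc k) ψ →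
                        ∃[ σ ] ∃[ π ] (InΣ (suc (suc k)) σ × InΠ (suc (suc k)) π × φ ∙ ψ ▷* σ × φ ∙ ψ ▷* π)
    ∙-prenex-opposite-classes {k = k} Q φ ψ hφ hψ =
      let σ , σ∈Σ , reduces-σ = prenexing ex
          π , π∈Π , reduces-π = prenexing all
      in σ , π , σ∈Σ , π∈Π , reduces-σ , reduces-π
      where
        prenexing : ∀ R → ∃[ σ ] (In R (suc (suc k)) σ × φ ∙ ψ ▷* σ)
        prenexing R = prenex-∙-In (In⇒Prenex Q _ hφ) (In⇒Prenex _ _ hψ)
                        λ b b′ → merge-opposite R (Blocks-map leftQuant-dual b) b′

lemma4p1 : (L : Signature) → let open Syntax L in
    (k : ℕ) (c : Conn) →
    (∀ φ ψ → InΣ⁺ (suc k) φ → InΣ⁺ (suc k) ψ → suc k ≡ deg φ ⊔ deg ψ →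
      ∃[ σ ] (InΣ (suc k) σ × (φ ⟨ c ⟩ ψ) ▷* σ))
    ×
    (∀ φ ψ → InΠ⁺ (suc k) φ → InΠ⁺ (suc k) ψ → suc k ≡ deg φ ⊔ deg ψ →
      ∃[ π ] (InΠ (suc k) π × (φ ⟨ c ⟩ ψ) ▷* π))
    ×
    (∀ φ ψ → InΣ (suc k) φ → InΠ (suc k) ψ →
      ∃[ σ ] ∃[ π ] (InΣ (suc (suc k)) σ × InΠ (suc (suc k)) π
        × (φ ⟨ c ⟩ ψ) ▷* σ × (φ ⟨ c ⟩ ψ) ▷* π))
    ×
    (∀ φ ψ → InΠ (suc k) φ → InΣ (suc k) ψ →
      ∃[ σ ] ∃[ π ] (InΣ (suc (suc k)) σ × InΠ (suc (suc k)) π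
        × (φ ⟨ c ⟩ ψ) ▷* σ × (φ ⟨ c ⟩ ψ) ▷* π))
    ×
    (∀ φ ψ → InΣ⁺ (suc k) φ → InΠ⁺ (suc k) ψ → suc k ≡ deg φ ⊔ deg ψ →
      ∃[ π ] (InΠ (suc k) π × (φ ⇒' ψ) ▷* π))
    ×
    (∀ φ ψ → InΠ⁺ (suc k) φ → InΣ⁺ (suc k) ψ → suc k ≡ deg φ ⊔ deg ψ →
      ∃[ σ ] (InΣ (suc k) σ × (φ ⇒' ψ) ▷* σ))
    ×
    (∀ φ ψ → InΣ (suc k) φ → InΣ (suc k) ψ →
      ∃[ σ ] ∃[ π ] (InΣ (suc (suc k)) σ × InΠ (suc (suc k)) π
        × (φ ⇒' ψ) ▷* σ × (φ ⇒' ψ) ▷* π))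
    ×
    (∀ φ ψ → InΠ (suc k) φ → InΠ (suc k) ψ →
      ∃[ σ ] ∃[ π ] (InΣ (suc (suc k)) σ × InΠ (suc (suc k)) π
        × (φ ⇒' ψ) ▷* σ × (φ ⇒' ψ) ▷* π))
lemma4p1 L k c =
  ∙-prenex-same-class       (connective c) ex , ∙-prenex-same-class       (connective c) all ,
  ∙-prenex-opposite-classes (connective c) ex , ∙-prenex-opposite-classes (connective c) all ,
  ∙-prenex-same-class       implication    ex , ∙-prenex-same-class       implication    all ,
  ∙-prenex-opposite-classes implication    ex , ∙-prenex-opposite-classes implication    all
  where
    open Syntax L using (ex; all)
    open PrenexNormalisation L
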